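{- Let $(\mathcal{W},\mathcal{P})$ be a stable regular decomposition of length $l\geq3$ and attachedness $p$ of a $p$-connected graph $G$, and set $\lambda=\{\alpha:P_\alpha\text{ non-trivial}\}$ and $\theta=\{\alpha:P_\alpha\text{ trivial}\}$. Let $\mathcal{Q}$ be a foundational linkage for $\mathcal{W}$ such that $\mathcal{Q}[W]$ is $p$-attached in $G[W]$ for each inner bag $W$ of $\mathcal{W}$. If $\lambda_0\subseteq\lambda$ is such that $|N(\alpha)\cap\theta|\leq p-3$ for each $\alpha\in\lambda_0$, where $N(\alpha)$ is the neighbourhood of $\alpha$ in $\Gamma(\mathcal{W},\mathcal{P})$, then every non-trivial $\mathcal{Q}$-bridge contained in $G[W]$ for some inner bag $W$ of $\mathcal{W}$ that attaches to a path of $\mathcal{Q}_{\lambda_0}=\{Q_\alpha:\alpha\in\lambda_0\}$ attaches to at least one other path of $\mathcal{Q}_\lambda=\{Q_\alpha:\alpha\in\lambda\}$.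
   Context: For $S\subseteq G$, an $S$-bridge is either an edge not in $S$ with both ends in $S$ (trivial), or for a component $C$ of $G-S$ the subgraph of all edges with an end in $C$ (non-trivial); its attachments are its vertices in $S$, and it attaches to $S'\subseteq S$ if it has an attachment in $S'$. For a linkage (set of disjoint paths) $\mathcal{Q}$, $\mathcal{Q}$-bridges are bridges of $\bigcup\mathcal{Q}$ (in $G$ unless another host graph is named). For $\mathcal{W}=(W_0,\ldots,W_l)$ with $W_i\subseteq V(G)$: $\mathcal{W}$ is a slim decomposition if (L1) the bags cover $V(G)$ and each edge lies in some $G[W_i]$; (L2) $W_i\cap W_k\subseteq W_j$ for $i\le j\le k$; (L3) all adhesion sets $W_{i-1}\cap W_i$ have the same size $q$; (L4) no bag contains another; (L5) there are $q$ disjoint $(W_0\cap W_1)$--$(W_{l-1}\cap W_l)$ paths. Such paths with an enumeration $P_1,\dots,P_q$ form a foundational linkage $\mathcal{P}$ (paths may be trivial); another foundational linkage $\mathcal{Q}=\{Q_1,\dots,Q_q\}$ is enumerated so that $Q_\alpha$ and $P_\alpha$ start at the same vertex. The $\alpha$-vertex of an adhesion set is its unique vertex on the $\alpha$-th path. Inner bags are $W_1,\dots,W_{l-1}$, with left/right adhesion sets $W_{i-1}\cap W_i$, $W_i\cap W_{i+1}$; for a foundational linkage $\mathcal{Q}$ and inner bag $W$, $Q_\alpha[W]$ is the subpath of $Q_\alpha$ between the left and right $\alpha$-vertex of $W$, $\mathcal{Q}[W]=\{Q_\alpha[W]\}$. A linkage in $G[W]$ from the left to the right adhesion set of inner bag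 $W$ is enumerated by its paths' starting $\alpha$-vertices; its induced permutation $\pi$ has the $\alpha$-th path ending at the right $\pi(\alpha)$-vertex. $B(H,\mathcal{Q})$ is the graph on $\{1,\dots,q\}$ with $\alpha\beta$ an edge iff some $\mathcal{Q}$-bridge in $H$ attaches to $Q_\alpha$ and $Q_\beta$. $\Gamma(\mathcal{W},\mathcal{P})=B(G[W_1\cup\dots\cup W_{l-1}],\mathcal{P}$ restricted to this subgraph$)$. A linkage $\mathcal{Q}$ in $H$ is $p$-attached if its paths are induced in $H$ and each non-trivial $\mathcal{Q}$-bridge in $H$ attaching to a non-trivial path $P$ either attaches to another non-trivial path or there are $\ge p-2$ trivial paths $Q\in\mathcal{Q}$ such that some $\mathcal{Q}$-bridge in $H$ attaches to $P$ and $Q$. $(\mathcal{W},\mathcal{P})$ is a regular decomposition of attachedness $p$ if (L6) $\mathcal{P}[W]$ is $p$-attached in $G[W]$ for each inner bag $W$; (L7) $P_\alpha$ is trivial whenever $P_\alpha[W]$ is trivial for some inner bag $W$; (L8) if some inner bag $W$ has a $\mathcal{P}[W]$-bridge in $G[W]$ attaching to $P_\alpha$ and $P_\beta$, then every inner bag has one. It is stable if for every inner bag $W$ and every linkage $\mathcal{Q}$ in $G[W]$ from the left to the right adhesion set of $W$: (L10) the induced permutation of $\mathcal{Q}$ is an automorphism of $\Gamma(\mathcal{W},\mathcal{P})$; (L11) every edge of $B(G[W],\mathcal{Q})$ with an end in $\lambda$ is an edge of $\Gamma(\mathcal{W},\mathcal{P})$. -}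

module Defs where

open import Data.Nat using (ℕ; zero; suc; _+_; _∸_; _≤_; _<_)
open import Data.Fin using (Fin)
open import Data.Unit using (⊤)
open import Data.Product using (Σ; ∃; ∃₂; _×_; _,_)
open import Data.Sum using (_⊎_)
open import Data.List using (List; []; _∷_; _++_; length)
open import Data.List.NonEmpty as L⁺ using (List⁺)
open import Data.List.Membership.Propositional using (_∈_)
open import Data.List.Relation.Unary.All using (All)
open import Data.List.Relation.Unary.Unique.Propositional using (Unique)
open import Data.List.Relation.Unary.Linked using (Linked)
open import Relation.Nullary using (¬_)
open import Relation.Binary.PropositionalEquality using (_≡_; _≢_)

record Graph (n : ℕ) : Set₁ where
  field
    Adj        : Fin n → Fin n → Set
    Adj-sym    : ∀ {u v} → Adj u v → Adj v u
    Adj-irrefl : ∀ {u} → ¬ Adj u u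
open Graph public

-- vertex sets (predicates); an induced subgraph G[U] is given by U
VSet : ℕ → Set₁
VSet n = Fin n → Set

Full : ∀ {n} → VSet n
Full _ = ⊤

Path : ℕ → Set
Path n = List⁺ (Fin n)

module _ {n : ℕ} where

  _∈P_ : Fin n → Path n → Set
  v ∈P P = v ∈ L⁺.toList P

  Trivial : Path n → Set
  Trivial P = L⁺.tail P ≡ []

  NonTrivial : Path n → Set
  NonTrivial P = ¬ Trivial P

  IsPathIn : Graph n → VSet n → Path n → Set
  IsPathIn G U P = Unique (L⁺.toList P) × Linked (Adj G) (L⁺.toList P)
                   × All U (L⁺.toList P)

  IsABPath : VSet n → VSet n → Path n → Set
  IsABPath A B P = A (L⁺.head P) × B (L⁺.last P)
                   × (∀ v → v ∈P P → A v → v ≡ L⁺.head P)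
                   × (∀ v → v ∈P P → B v → v ≡ L⁺.last P)

  Consec : Path n → Fin n → Fin n → Set
  Consec P u v = ∃₂ λ xs ys → L⁺.toList P ≡ xs ++ u ∷ v ∷ ys

  PathEdge : Path n → Fin n → Fin n → Set
  PathEdge P u v = Consec P u v ⊎ Consec P v u

  Connected : Graph n → VSet n → Set
  Connected G C = ∀ x y → C x → C y →
    ∃ λ P → IsPathIn G C P × L⁺.head P ≡ x × L⁺.last P ≡ y

  PConnected : Graph n → ℕ → Set
  PConnected G p = p < n ×
    (∀ (X : List (Fin n)) → length X < p →
       Connected G (λ w → ¬ (w ∈ X)))

  HasSize : VSet n → ℕ → Set
  HasSize S q = Σ (Fin q → Fin n) λ f →
    (∀ i j → f i ≡ f j → i ≡ j) × (∀ i → S (f i)) × (∀ v → S v → ∃ λ i → f i ≡ v)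

Linkage : ℕ → ℕ → Set
Linkage n q = Fin q → Path n

module _ {n q : ℕ} where

  IsLinkageIn : Graph n → VSet n → Linkage n q → Set
  IsLinkageIn G U Q = (∀ α → IsPathIn G U (Q α))
    × (∀ α β → α ≢ β → ∀ v → v ∈P Q α → ¬ (v ∈P Q β))

  OnLink : Linkage n q → Fin n → Set
  OnLink Q v = ∃ λ α → v ∈P Q α

  LinkEdge : Linkage n q → Fin n → Fin n → Set
  LinkEdge Q u v = ∃ λ α → PathEdge (Q α) u v

  TrivialBridge : Graph n → VSet n → Linkage n q → Fin n → Fin n → Set
  TrivialBridge G U Q u v = Adj G u v × U u × U v × OnLink Q u × OnLink Q v
                            × ¬ LinkEdge Q u v

  IsComponent : Graph n → VSet n → Linkage n q → VSet n → Set
  IsComponent G U Q C = (∀ v → C v → U v × ¬ OnLink Q v)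
    × (∃ λ c → C c)
    × Connected G C
    × (∀ x y → C x → U y → ¬ OnLink Q y → Adj G x y → C y)

  -- attachments of the non-trivial bridge belonging to the component C
  NTAttachment : Graph n → Linkage n q → VSet n → Fin n → Set
  NTAttachment G Q C s = OnLink Q s × ∃ λ c → C c × Adj G c s

  data Bridge (G : Graph n) (U : VSet n) (Q : Linkage n q) : Set₁ where
    trivB : (u v : Fin n) → TrivialBridge G U Q u v → Bridge G U Q
    ntB   : (C : VSet n) → IsComponent G U Q C → Bridge G U Q

  Attachment : ∀ {G U Q} → Bridge G U Q → Fin n → Set
  Attachment (trivB u v _) s = s ≡ u ⊎ s ≡ v
  Attachment {G} {U} {Q} (ntB C _) s = NTAttachment G Q C s

  AttachesTo : ∀ {G U Q} → Bridge G U Q → Path n → Set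
  AttachesTo B P = ∃ λ s → Attachment B s × s ∈P P

  BEdge : Graph n → VSet n → Linkage n q → Fin q → Fin q → Set₁
  BEdge G U Q α β = α ≢ β ×
    Σ (Bridge G U Q) λ B → AttachesTo B (Q α) × AttachesTo B (Q β)

  Induced : Graph n → Path n → Set
  Induced G P = ∀ u v → u ∈P P → v ∈P P → Adj G u v → PathEdge P u v

  PAttached : Graph n → VSet n → Linkage n q → ℕ → Set₁
  PAttached G U Q p = (∀ α → Induced G (Q α)) ×
    (∀ C (c : IsComponent G U Q C) α → NonTrivial (Q α) →
       AttachesTo (ntB {G = G} {U} {Q} C c) (Q α) →
       (∃ λ β → β ≢ α × NonTrivial (Q β) × AttachesTo (ntB {G = G} {U} {Q} C c) (Q β))
       ⊎ (∃ λ (βs : List (Fin q)) → Unique βs × p ≤ length βs + 2 ×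
            All (λ β → Trivial (Q β) ×
                   Σ (Bridge G U Q) λ B → AttachesTo B (Q α) × AttachesTo B (Q β)) βs))

-- Decompositions W = (W 0, ..., W l); values W i for i > l are irrelevant

module _ {n : ℕ} where

  Adh : (ℕ → VSet n) → ℕ → VSet n
  Adh W k v = W k v × W (suc k) v

  Inner : (ℕ → VSet n) → ℕ → VSet n
  Inner W l v = ∃ λ i → 0 < i × i < l × W i v

  module _ {q : ℕ} where

    IsFoundational : Graph n → ℕ → (ℕ → VSet n) → Linkage n q → Set
    IsFoundational G l W Q = IsLinkageIn G Full Q
      × (∀ α → IsABPath (Adh W 0) (Adh W (l ∸ 1)) (Q α))

    -- R α = Q α [W (suc k)] : subpath of Q α between its vertices in the
    -- left adhesion set W k ∩ W (k+1) and the right one W (k+1) ∩ W (k+2)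
    Restr : (ℕ → VSet n) → Linkage n q → ℕ → Linkage n q → Set
    Restr W Q k R = ∀ α →
      (∃₂ λ xs ys → L⁺.toList (Q α) ≡ xs ++ L⁺.toList (R α) ++ ys)
      × Adh W k (L⁺.head (R α)) × Adh W (suc k) (L⁺.last (R α))

    Γ : Graph n → ℕ → (ℕ → VSet n) → Linkage n q → Fin q → Fin q → Set₁
    Γ G l W P = BEdge G (Inner W l) P

    IsSlim : Graph n → ℕ → (ℕ → VSet n) → Set
    IsSlim G l W =
      ((∀ v → ∃ λ i → i ≤ l × W i v)
       × (∀ u v → Adj G u v → ∃ λ i → i ≤ l × W i u × W i v))
      × (∀ i j k → i ≤ j → j ≤ k → k ≤ l → ∀ v → W i v → W k v → W j v)
      × (∀ k → k < l → HasSize (Adh W k) q)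
      × (∀ i j → i ≤ l → j ≤ l → i ≢ j → ¬ (∀ v → W i v → W j v))
      × (∃ λ (Q : Linkage n q) → IsFoundational G l W Q)

    IsRegular : Graph n → ℕ → ℕ → (ℕ → VSet n) → Linkage n q → Set₁
    IsRegular G l p W P = IsSlim G l W × IsFoundational G l W P
      × (∀ k → suc k < l → ∀ R → Restr W P k R → PAttached G (W (suc k)) R p)
      × (∀ α k → suc k < l → ∀ R → Restr W P k R → Trivial (R α) → Trivial (P α))
      × (∀ α β k k' → suc k < l → suc k' < l → ∀ R R' →
           Restr W P k R → Restr W P k' R' →
           BEdge G (W (suc k)) R α β → BEdge G (W (suc k')) R' α β)

    -- R is a linkage in G[W (k+1)] from the left to the right adhesion set,
    -- enumerated so that R α starts at the left α-vertex (the one on P α)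
    IsLRLinkage : Graph n → (ℕ → VSet n) → Linkage n q → ℕ → Linkage n q → Set
    IsLRLinkage G W P k R = IsLinkageIn G (W (suc k)) R
      × (∀ α → IsABPath (Adh W k) (Adh W (suc k)) (R α))
      × (∀ α → L⁺.head (R α) ∈P P α)

    IsAutomorphism : (Fin q → Fin q → Set₁) → (Fin q → Fin q) → Set₁
    IsAutomorphism E π = ((∀ α β → π α ≡ π β → α ≡ β) × (∀ β → ∃ λ α → π α ≡ β))
      × (∀ α β → (E α β → E (π α) (π β)) × (E (π α) (π β) → E α β))

    IsStable : Graph n → ℕ → (ℕ → VSet n) → Linkage n q → Set₁
    IsStable G l W P = ∀ k → suc k < l → ∀ R → IsLRLinkage G W P k R →
      (∀ (π : Fin q → Fin q) → (∀ α → L⁺.last (R α) ∈P P (π α)) →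
         IsAutomorphism (Γ G l W P) π)
      × (∀ α β → BEdge G (W (suc k)) R α β →
           (NonTrivial (P α) ⊎ NonTrivial (P β)) → Γ G l W P α β)

module Submission where

-- A foundational linkage meets every adhesion set exactly once on each path, so at the k-th adhesion
-- set the paths of Q and P are matched by a permutation σₖ of the indices.  σ₀ is the identity and
-- σₖ₊₁σₖ⁻¹ is the permutation induced by the linkage Q[Wₖ₊₁], so by (L10) every σₖ is an automorphism
-- of Γ = Γ(W, P); together with (L11) this turns a Q[W]-bridge in G[W] attaching to Q_α and Q_β, with
-- P_α non-trivial, into an edge αβ of Γ.
--
-- Now let a bridge B in G[W] attach to Q_α with α ∈ λ₀.  If Q_α[W] is non-trivial, p-attachedness of
-- Q[W] yields either a second non-trivial path or p − 2 trivial paths adjacent to α in Γ, and the latter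
-- contradicts |N(α) ∩ θ| ≤ p − 3.  If Q_α[W] is a single vertex x, deleting x and the trivial
-- Γ-neighbours of α found so far removes fewer than p vertices, so B has an attachment outside them: it
-- lies on a non-trivial path, or on a new trivial Γ-neighbour of α, which can happen only p − 3 times.

open import Defs
open import Data.Nat using (ℕ; zero; suc; _+_; _∸_; _≤_; _<_; z≤n; s≤s; _≤?_)
open import Data.Nat.Properties
  using (≤-refl; ≤-trans; n≤1+n; n<1+n; <-trans; ≰⇒>; <⇒≱; <-cmp; m<1+n⇒m≤n; +-suc; +-comm;
         +-identityʳ; +-cancelˡ-≤; m+n≤o⇒m≤o∸n)
open import Data.Fin using (Fin; punchOut) renaming (_≟_ to _≟F_)
open import Data.Fin.Properties using (any?; punchOut-injective; injective⇒≤)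
open import Data.Product using (Σ; ∃; ∃₂; _×_; _,_; proj₁; proj₂)
open import Data.Sum using (_⊎_; inj₁; inj₂)
open import Data.Empty using (⊥-elim)
open import Data.Unit using (tt)
open import Data.List using (List; []; _∷_; _++_; [_]; length; map)
open import Data.List.Properties using (++-assoc; ∷ʳ-injectiveʳ; ++-conicalʳ; ∷-injectiveʳ; length-map)
open import Data.List.NonEmpty as L⁺ using (List⁺; _∷_; _∷ʳ_)
open import Data.List.Relation.Unary.Any using (here; there)
open import Data.List.Relation.Unary.All as All using (All; []; _∷_)
import Data.List.Relation.Unary.All.Properties as All
open import Data.List.Relation.Unary.AllPairs using ([]; _∷_)
open import Data.List.Relation.Unary.Linked as Linked using (Linked; []; [-]; _∷_)
open import Data.List.Relation.Unary.Unique.Propositional using (Unique)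
open import Data.List.Membership.Propositional using (_∈_; _∉_)
open import Data.List.Membership.Propositional.Properties using (∈-++⁺ˡ; ∈-++⁺ʳ; ∈-++⁻; ∈-map⁺; ∈-map⁻; ∈-∃++)
import Data.List.Membership.DecPropositional as DecMembership
open import Relation.Nullary using (¬_; Dec; yes; no)
open import Relation.Binary.Definitions using (tri<; tri≈; tri>)
open import Relation.Binary.PropositionalEquality
  using (_≡_; _≢_; _≗_; refl; sym; trans; cong; subst; subst₂; module ≡-Reasoning)

injective⇒surjective : ∀ {m} (f : Fin m → Fin m) → (∀ {a b} → f a ≡ f b → a ≡ b) → ∀ b → ∃ λ a → f a ≡ b
injective⇒surjective {suc m} f f-inj b with any? (λ a → f a ≟F b)
... | yes hit = hit
... | no miss = ⊥-elim (<⇒≱ (n<1+n m) (injective⇒≤ {f = g} g-inj))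
  where
  g : Fin (suc m) → Fin m
  g a = punchOut {i = b} (λ eq → miss (a , sym eq))
  g-inj : ∀ {a c} → g a ≡ g c → a ≡ c
  g-inj {a} {c} eq = f-inj (punchOut-injective {i = b} (λ e → miss (a , sym e)) (λ e → miss (c , sym e)) eq)

m<n⇒suc[n∸1]≡n : ∀ {m n} → m < n → suc (n ∸ 1) ≡ n
m<n⇒suc[n∸1]≡n (s≤s _) = refl

module _ {A : Set} where

  Unique-++⁻ˡ : ∀ {xs ys : List A} → Unique (xs ++ ys) → Unique xs
  Unique-++⁻ˡ {[]} _ = []
  Unique-++⁻ˡ {x ∷ xs} (x∉ ∷ u) = All.++⁻ˡ xs x∉ ∷ Unique-++⁻ˡ u

  Unique-++⁻ʳ : ∀ {xs ys : List A} → Unique (xs ++ ys) → Unique ys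
  Unique-++⁻ʳ {[]} u = u
  Unique-++⁻ʳ {x ∷ xs} (_ ∷ u) = Unique-++⁻ʳ u

  Unique-++-disjoint : ∀ {xs ys : List A} {x} → Unique (xs ++ ys) → x ∈ xs → x ∉ ys
  Unique-++-disjoint {_ ∷ xs} (x∉ ∷ _) (here refl) x∈ys = All.lookup x∉ (∈-++⁺ʳ xs x∈ys) refl
  Unique-++-disjoint (_ ∷ u) (there x∈xs) = Unique-++-disjoint u x∈xs

  Unique-pivot : ∀ {xs ys : List A} {x y} → Unique (xs ++ y ∷ ys) → x ∈ xs ++ [ y ] → x ∈ y ∷ ys → x ≡ y
  Unique-pivot {xs} u x∈ x∈′ with ∈-++⁻ xs x∈
  ... | inj₁ x∈xs = ⊥-elim (Unique-++-disjoint u x∈xs x∈′)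
  ... | inj₂ (here x≡y) = x≡y

  last∈-++ʳ : ∀ (xs ys zs : List A) {v z} → xs ++ ys ≡ zs ++ [ z ] → v ∈ ys → z ∈ ys
  last∈-++ʳ [] ys zs refl _ = ∈-++⁺ʳ zs (here refl)
  last∈-++ʳ (x ∷ xs) ys [] eq v∈ with ++-conicalʳ xs ys (∷-injectiveʳ eq)
  last∈-++ʳ (x ∷ xs) [] [] eq () | refl
  last∈-++ʳ (x ∷ xs) ys (z ∷ zs) eq v∈ = last∈-++ʳ xs ys zs (∷-injectiveʳ eq) v∈

  module _ {R : A → A → Set} where

    Linked-++⁻ˡ : ∀ {xs ys} → Linked R (xs ++ ys) → Linked R xs
    Linked-++⁻ˡ {[]} _ = []
    Linked-++⁻ˡ {x ∷ []} _ = [-]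
    Linked-++⁻ˡ {x ∷ y ∷ xs} (r ∷ rs) = r ∷ Linked-++⁻ˡ rs

    Linked-++⁻ʳ : ∀ {xs ys} → Linked R (xs ++ ys) → Linked R ys
    Linked-++⁻ʳ {[]} rs = rs
    Linked-++⁻ʳ {x ∷ xs} rs = Linked-++⁻ʳ {xs} (Linked.tail rs)

    module _ {S T X : A → Set} (step : ∀ {u v} → R u v → S u → S v ⊎ X u) (meet : ∀ {v} → S v → T v → X v) where

      Linked-reach : ∀ {a as z} → Linked R (a ∷ as) → S a → z ∈ a ∷ as → T z → ∃ λ v → v ∈ a ∷ as × X v
      Linked-reach _ sa (here refl) tz = _ , here refl , meet sa tz
      Linked-reach [-] _ (there ())
      Linked-reach (r ∷ rs) sa (there z∈) tz with step r sa
      ... | inj₂ xa = _ , here refl , xa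
      ... | inj₁ sb with Linked-reach rs sb z∈ tz
      ...   | v , v∈ , xv = v , there v∈ , xv

    module _ {C D : A → Set} (D? : ∀ v → Dec (D v)) (C∩D=∅ : ∀ {v} → C v → ¬ D v)
             (closed : ∀ {u v} → C u → R u v → ¬ D v → C v) where

      Linked-exit : ∀ {a as z} → Linked R (a ∷ as) → C a → z ∈ a ∷ as → D z →
                    ∃ λ v → v ∈ a ∷ as × D v × ∃ λ u → C u × R u v
      Linked-exit _ ca (here refl) dz = ⊥-elim (C∩D=∅ ca dz)
      Linked-exit [-] _ (there ())
      Linked-exit {as = b ∷ _} (r ∷ rs) ca (there z∈) dz with D? b
      ... | yes db = b , there (here refl) , db , _ , ca , r
      ... | no ¬db with Linked-exit rs (closed ca r ¬db) z∈ dz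
      ...   | v , v∈ , dv , u = v , there v∈ , dv , u

  boundedGrowth : ∀ {g ℓ} {Good : A → Set g} {Goal : Set ℓ} (b : ℕ)
    → (∀ xs → Unique xs → All Good xs → length xs ≤ b)
    → (∀ xs → Unique xs → All Good xs → Goal ⊎ ∃ λ x → x ∉ xs × Good x)
    → Goal
  boundedGrowth {Good = Good} {Goal = Goal} b bounded extend = grow (suc b) [] [] [] ≤-refl
    where
    grow : ∀ d xs → Unique xs → All Good xs → b < length xs + d → Goal
    grow zero xs u g b< = ⊥-elim (<⇒≱ (subst (b <_) (+-identityʳ (length xs)) b<) (bounded xs u g))
    grow (suc d) xs u g b< with extend xs u g
    ... | inj₁ goal = goal
    ... | inj₂ (x , x∉ , gx) =
      grow d (x ∷ xs) (All.¬Any⇒All¬ xs x∉ ∷ u) (gx ∷ g) (subst (b <_) (+-suc (length xs) d) b<)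

  head∈toList : (xs : List⁺ A) → L⁺.head xs ∈ L⁺.toList xs
  head∈toList (x ∷ xs) = here refl

  toList≡init++last : (xs : List⁺ A) → ∃ λ ys → L⁺.toList xs ≡ ys ++ [ L⁺.last xs ]
  toList≡init++last xs with L⁺.snocView xs
  ... | [] L⁺.∷ʳ′ x = [] , refl
  ... | (y ∷ ys) L⁺.∷ʳ′ x = y ∷ ys , refl

  head∈prefix : (xs : List⁺ A) (ys zs : List A) {v : A} → L⁺.toList xs ≡ ys ++ zs → v ∈ ys → L⁺.head xs ∈ ys
  head∈prefix (x ∷ xs) (y ∷ ys) zs refl _ = here refl

  last-unique : (xs : List⁺ A) (ys : List A) {z : A} → L⁺.toList xs ≡ ys ++ [ z ] → L⁺.last xs ≡ z
  last-unique xs ys eq with toList≡init++last xs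
  ... | ys′ , eq′ = sym (∷ʳ-injectiveʳ ys ys′ (trans (sym eq) eq′))

  last∈suffix : (xs : List⁺ A) (ys zs : List A) {v : A} → L⁺.toList xs ≡ ys ++ zs → v ∈ zs → L⁺.last xs ∈ zs
  last∈suffix xs ys zs eq v∈ with toList≡init++last xs
  ... | ys′ , eq′ = last∈-++ʳ ys zs ys′ (trans (sym eq) eq′) v∈

  last∈toList : (xs : List⁺ A) → L⁺.last xs ∈ L⁺.toList xs
  last∈toList xs = last∈suffix xs [] (L⁺.toList xs) refl (head∈toList xs)

  toList-∷ʳ : (ys : List A) (z : A) → L⁺.toList (ys ∷ʳ z) ≡ ys ++ [ z ]
  toList-∷ʳ [] z = refl
  toList-∷ʳ (y ∷ ys) z = refl

  head-∷ʳ : ∀ {x : A} {xs ys z zs} → x ∷ xs ≡ ys ++ z ∷ zs → L⁺.head (ys ∷ʳ z) ≡ x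
  head-∷ʳ {ys = []} refl = refl
  head-∷ʳ {ys = _ ∷ _} refl = refl

  last-∷ʳ : (ys : List A) (z : A) → L⁺.last (ys ∷ʳ z) ≡ z
  last-∷ʳ ys z = last-unique (ys ∷ʳ z) ys (toList-∷ʳ ys z)

module _ {n : ℕ} where

  head≡last⇒Trivial : (P : Path n) → Unique (L⁺.toList P) → L⁺.head P ≡ L⁺.last P → Trivial P
  head≡last⇒Trivial (h ∷ []) _ _ = refl
  head≡last⇒Trivial (h ∷ y ∷ ys) (h∉ ∷ _) h≡last =
    ⊥-elim (All.lookup h∉ (subst (_∈ y ∷ ys) (sym h≡last) (last∈suffix (h ∷ y ∷ ys) [ h ] (y ∷ ys) refl (here refl)))
                          refl)

  Trivial⇒last≡head : (P : Path n) → Trivial P → L⁺.last P ≡ L⁺.head P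
  Trivial⇒last≡head (h ∷ []) refl = refl

  Trivial⇒≡head : (P : Path n) {v : Fin n} → Trivial P → v ∈P P → v ≡ L⁺.head P
  Trivial⇒≡head (h ∷ []) refl (here v≡h) = v≡h

  Trivial? : (P : Path n) → Dec (Trivial P)
  Trivial? (h ∷ []) = yes refl
  Trivial? (h ∷ y ∷ ys) = no λ ()

  NonTrivial⇒∃≢ : (P : Path n) → Unique (L⁺.toList P) → NonTrivial P → ∀ x → ∃ λ y → y ∈P P × y ≢ x
  NonTrivial⇒∃≢ (h ∷ []) _ nt x = ⊥-elim (nt refl)
  NonTrivial⇒∃≢ (h ∷ y ∷ ys) ((h≢y ∷ _) ∷ _) nt x with x ≟F h
  ... | yes x≡h = y , there (here refl) , λ y≡x → h≢y (sym (trans y≡x x≡h))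
  ... | no x≢h = h , here refl , λ h≡x → x≢h (sym h≡x)

module _ {n q : ℕ} where

  linkage-index-unique : ∀ {G U} {F : Linkage n q} → IsLinkageIn G U F →
                         ∀ {α β v} → v ∈P F α → v ∈P F β → α ≡ β
  linkage-index-unique (_ , disjoint) {α} {β} {v} v∈α v∈β with α ≟F β
  ... | yes α≡β = α≡β
  ... | no α≢β = ⊥-elim (disjoint α β α≢β v v∈α v∈β)

  OnLink? : (F : Linkage n q) → ∀ v → Dec (OnLink F v)
  OnLink? F v = any? (λ α → DecMembership._∈?_ _≟F_ v (L⁺.toList (F α)))

  component-attachment-avoiding : ∀ {G : Graph n} {p} {Q : Linkage n q} {C} →
    PConnected G p → IsComponent G Full Q C →
    ∀ X → length X < p → (∀ {v} → v ∈ X → OnLink Q v) → ∀ {y} → OnLink Q y → y ∉ X →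
    ∃ λ s → s ∉ X × NTAttachment G Q C s
  component-attachment-avoiding {Q = Q} {C} (_ , connected) (C∩Q=∅ , (c₀ , c₀∈C) , _ , closed)
                                X |X|<p X⊆Q {y} y∈Q y∉X
    with connected X |X|<p c₀ y (λ c₀∈X → proj₂ (C∩Q=∅ c₀ c₀∈C) (X⊆Q c₀∈X)) y∉X
  ... | path , (_ , linked , avoids-X) , head≡c₀ , last≡y
    with Linked-exit (OnLink? Q) (λ cv → proj₂ (C∩Q=∅ _ cv)) (λ cu uv ¬Qv → closed _ _ cu tt ¬Qv uv)
                     linked (subst C (sym head≡c₀) c₀∈C) (last∈toList path) (subst (OnLink Q) (sym last≡y) y∈Q)
  ...   | s , s∈ , s∈Q , u , u∈C , us = s , All.lookup avoids-X s∈ , s∈Q , u , u∈C , us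

  module _ {E : Fin q → Fin q → Set₁} where

    IsAutomorphism-id : IsAutomorphism {n} E (λ α → α)
    IsAutomorphism-id = ((λ _ _ eq → eq) , (λ β → β , refl)) , λ _ _ → (λ e → e) , (λ e → e)

    IsAutomorphism-resp : ∀ {f g} → f ≗ g → IsAutomorphism {n} E f → IsAutomorphism {n} E g
    IsAutomorphism-resp {f} {g} f≗g ((f-inj , f-onto) , f-hom) =
      ((λ α β eq → f-inj α β (trans (f≗g α) (trans eq (sym (f≗g β))))) ,
       (λ β → let a , fa≡β = f-onto β in a , trans (sym (f≗g a)) fa≡β)) ,
      λ α β → (λ e → subst₂ E (f≗g α) (f≗g β) (proj₁ (f-hom α β) e)) ,
              (λ e → proj₂ (f-hom α β) (subst₂ E (sym (f≗g α)) (sym (f≗g β)) e))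

    IsAutomorphism-∘ : ∀ {f g} → IsAutomorphism {n} E f → IsAutomorphism {n} E g →
                       IsAutomorphism {n} E (λ α → f (g α))
    IsAutomorphism-∘ {f} {g} ((f-inj , f-onto) , f-hom) ((g-inj , g-onto) , g-hom) =
      ((λ α β eq → g-inj α β (f-inj (g α) (g β) eq)) ,
       (λ β → let a , fa≡β = f-onto β ; a′ , ga′≡a = g-onto a in a′ , trans (cong f ga′≡a) fa≡β)) ,
      λ α β → (λ e → proj₁ (f-hom (g α) (g β)) (proj₁ (g-hom α β) e)) ,
              (λ e → proj₂ (g-hom α β) (proj₂ (f-hom (g α) (g β)) e))

  module Relabel {G : Graph n} {U : VSet n} (R : Linkage n q)
                 {τ τ⁻¹ : Fin q → Fin q} (τ⁻¹∘τ : ∀ α → τ⁻¹ (τ α) ≡ α) where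

    R′ : Linkage n q
    R′ γ = R (τ⁻¹ γ)

    private
      onLink⁺ : ∀ {v} → OnLink R v → OnLink R′ v
      onLink⁺ {v} (α , v∈) = τ α , subst (λ β → v ∈P R β) (sym (τ⁻¹∘τ α)) v∈

      onLink⁻ : ∀ {v} → OnLink R′ v → OnLink R v
      onLink⁻ (γ , v∈) = τ⁻¹ γ , v∈

    bridge : Bridge G U R → Bridge G U R′
    bridge (trivB u v (uv , Uu , Uv , u∈ , v∈ , uv∉R)) =
      trivB u v (uv , Uu , Uv , onLink⁺ u∈ , onLink⁺ v∈ , λ { (γ , e) → uv∉R (τ⁻¹ γ , e) })
    bridge (ntB C (C⊆ , inhabited , connected , closed)) =
      ntB C ((λ v cv → proj₁ (C⊆ v cv) , λ v∈ → proj₂ (C⊆ v cv) (onLink⁻ v∈)) , inhabited , connected ,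
             λ x y cx Uy y∉ adj → closed x y cx Uy (λ y∈ → y∉ (onLink⁺ y∈)) adj)

    attaches : ∀ (B : Bridge G U R) {α} → AttachesTo B (R α) → AttachesTo (bridge B) (R′ (τ α))
    attaches (trivB u v _) {α} (s , att , s∈) = s , att , subst (λ β → s ∈P R β) (sym (τ⁻¹∘τ α)) s∈
    attaches (ntB C _) {α} (s , (s∈R , adj) , s∈) =
      s , (onLink⁺ s∈R , adj) , subst (λ β → s ∈P R β) (sym (τ⁻¹∘τ α)) s∈

  module Sublinkage {G : Graph n} {U : VSet n} {Q R : Linkage n q}
                    (R⊆Q : ∀ {α v} → v ∈P R α → v ∈P Q α)
                    (Q∩U⊆R : ∀ {α v} → v ∈P Q α → U v → v ∈P R α) where

    component : ∀ {C} → (∀ v → C v → U v) → IsComponent G Full Q C → IsComponent G U R C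
    component C⊆U (C∩Q=∅ , inhabited , connected , closed) =
      (λ v cv → C⊆U v cv , λ { (γ , v∈) → proj₂ (C∩Q=∅ v cv) (γ , R⊆Q v∈) }) , inhabited , connected ,
      λ x y cx Uy y∉R adj → closed x y cx tt (λ { (γ , y∈) → y∉R (γ , Q∩U⊆R y∈ Uy) }) adj

    attaches⁺ : ∀ {C} (C⊆U : ∀ v → C v → U v) (c : IsComponent G Full Q C) →
                (∀ s → NTAttachment G Q C s → U s) →
                ∀ {α} → AttachesTo (ntB {G = G} {Full} {Q} C c) (Q α) →
                AttachesTo (ntB {G = G} {U} {R} C (component C⊆U c)) (R α)
    attaches⁺ C⊆U c att⊆U (s , att , s∈) = s , ((_ , s∈R) , proj₂ att) , s∈R
      where s∈R = Q∩U⊆R s∈ (att⊆U s att)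

    attaches⁻ : ∀ {C} {c : IsComponent G Full Q C} {c′ : IsComponent G U R C} {α} →
                AttachesTo (ntB {G = G} {U} {R} C c′) (R α) → AttachesTo (ntB {G = G} {Full} {Q} C c) (Q α)
    attaches⁻ (s , ((γ , s∈γ) , adj) , s∈) = s , ((γ , R⊆Q s∈γ) , adj) , R⊆Q s∈

module SlimDecomposition {n q : ℕ} {G : Graph n} {l : ℕ} {W : ℕ → VSet n}
                         (slim : IsSlim {q = q} G l W) where

  private
    bag-cover : ∀ v → ∃ λ i → i ≤ l × W i v
    bag-cover = proj₁ (proj₁ slim)

    edge-cover : ∀ u v → Adj G u v → ∃ λ i → i ≤ l × W i u × W i v
    edge-cover = proj₂ (proj₁ slim)

    interpolate : ∀ i j k → i ≤ j → j ≤ k → k ≤ l → ∀ v → W i v → W k v → W j v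
    interpolate = proj₁ (proj₂ slim)

    adhesion-size : ∀ k → k < l → HasSize (Adh W k) q
    adhesion-size = proj₁ (proj₂ (proj₂ slim))

  LeftOf RightOf : ℕ → VSet n
  LeftOf k v = ∃ λ i → i ≤ k × W i v
  RightOf k v = ∃ λ j → k < j × j ≤ l × W j v

  LeftOf∩RightOf⊆Adh : ∀ {k v} → LeftOf k v → RightOf k v → Adh W k v
  LeftOf∩RightOf⊆Adh {k} {v} (i , i≤k , Wi) (j , k<j , j≤l , Wj) =
    interpolate i k j i≤k (≤-trans (n≤1+n k) k<j) j≤l v Wi Wj ,
    interpolate i (suc k) j (≤-trans i≤k (n≤1+n k)) k<j j≤l v Wi Wj

  private
    LeftOf-step : ∀ {k u v} → Adj G u v → LeftOf k u → LeftOf k v ⊎ Adh W k u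
    LeftOf-step {k} {u} {v} uv u-left with edge-cover u v uv
    ... | i , i≤l , Wu , Wv with i ≤? k
    ...   | yes i≤k = inj₁ (i , i≤k , Wv)
    ...   | no i≰k = inj₂ (LeftOf∩RightOf⊆Adh u-left (i , ≰⇒> i≰k , i≤l , Wu))

    RightOf-step : ∀ {k u v} → Adj G u v → RightOf k u → RightOf k v ⊎ Adh W k u
    RightOf-step {k} {u} {v} uv u-right with edge-cover u v uv
    ... | i , i≤l , Wu , Wv with i ≤? k
    ...   | yes i≤k = inj₂ (LeftOf∩RightOf⊆Adh (i , i≤k , Wu) u-right)
    ...   | no i≰k = inj₁ (i , ≰⇒> i≰k , i≤l , Wv)

  adhesion-separates : ∀ {k L x z} → Linked (Adj G) L → x ∈ L → z ∈ L → LeftOf k x → RightOf k z →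
                       ∃ λ v → v ∈ L × Adh W k v
  adhesion-separates {k} lk (here refl) z∈ lx rz =
    Linked-reach (LeftOf-step {k}) LeftOf∩RightOf⊆Adh lk lx z∈ rz
  adhesion-separates {k} lk (there x∈) (here refl) lx rz =
    Linked-reach (RightOf-step {k}) (λ r l → LeftOf∩RightOf⊆Adh l r) lk rz (there x∈) lx
  adhesion-separates lk (there x∈) (there z∈) lx rz with adhesion-separates (Linked.tail lk) x∈ z∈ lx rz
  ... | v , v∈ , adh = v , there v∈ , adh

  module Foundational {F : Linkage n q} (fF : IsFoundational G l W F) where

    path-unique : ∀ α → Unique (L⁺.toList (F α))
    path-unique α = proj₁ (proj₁ (proj₁ fF) α)

    path-linked : ∀ α → Linked (Adj G) (L⁺.toList (F α))
    path-linked α = proj₁ (proj₂ (proj₁ (proj₁ fF) α))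

    index-unique : ∀ {α β v} → v ∈P F α → v ∈P F β → α ≡ β
    index-unique = linkage-index-unique {G = G} {U = Full} (proj₁ fF)

    head-LeftOf : ∀ k α → LeftOf k (L⁺.head (F α))
    head-LeftOf k α = 0 , z≤n , proj₁ (proj₁ (proj₂ fF α))

    last-RightOf : ∀ {k} → k < l → ∀ α → RightOf k (L⁺.last (F α))
    last-RightOf k<l α =
      l , k<l , ≤-refl , subst (λ i → W i _) (m<n⇒suc[n∸1]≡n k<l) (proj₂ (proj₁ (proj₂ (proj₂ fF α))))

    opaque
      adhesion-meets : ∀ {j} → j < l → ∀ α → ∃ λ v → v ∈P F α × Adh W j v
      adhesion-meets {j} j<l α = adhesion-separates (path-linked α) (head∈toList (F α)) (last∈toList (F α))
                                   (head-LeftOf j α) (last-RightOf j<l α)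

    -- The q paths meet the q-element adhesion set at q distinct vertices, which therefore exhaust it.
    private
      module Counting {j} (j<l : j < l) where

        meet : Fin q → Fin n
        meet α = proj₁ (adhesion-meets j<l α)

        meet∈ : ∀ α → meet α ∈P F α
        meet∈ α = proj₁ (proj₂ (adhesion-meets j<l α))

        meet-adh : ∀ α → Adh W j (meet α)
        meet-adh α = proj₂ (proj₂ (adhesion-meets j<l α))

        enum : Fin q → Fin n
        enum = proj₁ (adhesion-size j j<l)

        enum-onto : ∀ v → Adh W j v → ∃ λ i → enum i ≡ v
        enum-onto = proj₂ (proj₂ (proj₂ (adhesion-size j j<l)))

        index : Fin q → Fin q
        index α = proj₁ (enum-onto (meet α) (meet-adh α))

        enum-index : ∀ α → enum (index α) ≡ meet α
        enum-index α = proj₂ (enum-onto (meet α) (meet-adh α))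

        index-injective : ∀ {α β} → index α ≡ index β → α ≡ β
        index-injective {α} {β} eq =
          index-unique (meet∈ α)
            (subst (_∈P F β) (trans (sym (enum-index β)) (trans (cong enum (sym eq)) (enum-index α))) (meet∈ β))

        meet-onto : ∀ v → Adh W j v → ∃ λ β → meet β ≡ v
        meet-onto v adh with enum-onto v adh
        ... | i , enum-i≡v with injective⇒surjective index index-injective i
        ...   | β , index-β≡i = β , trans (sym (enum-index β)) (trans (cong enum index-β≡i) enum-i≡v)

        adh∩path≡meet : ∀ {α v} → v ∈P F α → Adh W j v → v ≡ meet α
        adh∩path≡meet {α} {v} v∈ adh =
          let β , meet-β≡v = meet-onto v adh
          in trans (sym meet-β≡v) (cong meet (index-unique (subst (_∈P F β) meet-β≡v (meet∈ β)) v∈))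

    adhesion-meets-once : ∀ {j} → j < l → ∀ {α v w} → v ∈P F α → w ∈P F α → Adh W j v → Adh W j w → v ≡ w
    adhesion-meets-once j<l v∈ w∈ av aw = trans (adh∩path≡meet v∈ av) (sym (adh∩path≡meet w∈ aw))
      where open Counting j<l

    adhesion⊆linkage : ∀ {j} → j < l → ∀ {v} → Adh W j v → OnLink F v
    adhesion⊆linkage j<l {v} adh = let β , meet-β≡v = meet-onto v adh in β , subst (_∈P F β) meet-β≡v (meet∈ β)
      where open Counting j<l

    segment-crossing : ∀ {j} → j < l → ∀ {α S x z w} → Linked (Adj G) S → (∀ {v} → v ∈ S → v ∈P F α) →
                       x ∈ S → z ∈ S → LeftOf j x → RightOf j z → w ∈P F α → Adh W j w → w ∈ S
    segment-crossing j<l lk S⊆F x∈ z∈ lx rz w∈ aw with adhesion-separates lk x∈ z∈ lx rz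
    ... | v , v∈ , av = subst (_∈ _) (adhesion-meets-once j<l (S⊆F v∈) w∈ av aw) v∈

    head∈lastAdh⇒Trivial : ∀ α → Adh W (l ∸ 1) (L⁺.head (F α)) → Trivial (F α)
    head∈lastAdh⇒Trivial α adh =
      head≡last⇒Trivial (F α) (path-unique α) (proj₂ (proj₂ (proj₂ (proj₂ fF α))) _ (head∈toList (F α)) adh)

    opaque
      restriction : ∀ {k} → suc k < l → Σ (Linkage n q) (Restr W F k)
      restriction {k} k+1<l = (λ α → proj₁ (subpath α)) , (λ α → proj₂ (subpath α))
        where
        k<l : k < l
        k<l = <-trans (n<1+n k) k+1<l

        subpath : ∀ α → Σ (Path n) λ r → (∃₂ λ xs ys → L⁺.toList (F α) ≡ xs ++ L⁺.toList r ++ ys)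
                                         × Adh W k (L⁺.head r) × Adh W (suc k) (L⁺.last r)
        subpath α with adhesion-meets k<l α | adhesion-meets k+1<l α
        ... | a , a∈ , a-adh | b , b∈ , b-adh with ∈-∃++ a∈
        ...   | xs , rest , F≡ with ∈-++⁻ xs (subst (b ∈_) F≡ b∈)
        ...     | inj₁ b∈xs = ⊥-elim (Unique-++-disjoint (subst Unique F≡ (path-unique α)) a∈xs (here refl))
          where
          -- b lies beyond the k-th adhesion set, so the prefix ending at b would have to contain a.
          a∈xs : a ∈ xs
          a∈xs = segment-crossing k<l (Linked-++⁻ˡ (subst (Linked (Adj G)) F≡ (path-linked α)))
                   (λ v∈ → subst (_ ∈_) (sym F≡) (∈-++⁺ˡ v∈)) (head∈prefix (F α) xs _ F≡ b∈xs) b∈xs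
                   (head-LeftOf k α) (suc (suc k) , n≤1+n (suc k) , k+1<l , proj₂ b-adh) a∈ a-adh
        ...     | inj₂ b∈a∷rest with ∈-∃++ b∈a∷rest
        ...       | ys , zs , a∷rest≡ =
          ys ∷ʳ b , (xs , zs , F≡xs+r+zs) ,
          subst (Adh W k) (sym (head-∷ʳ a∷rest≡)) a-adh , subst (Adh W (suc k)) (sym (last-∷ʳ ys b)) b-adh
          where
          open ≡-Reasoning
          F≡xs+r+zs : L⁺.toList (F α) ≡ xs ++ L⁺.toList (ys ∷ʳ b) ++ zs
          F≡xs+r+zs = begin
            L⁺.toList (F α)           ≡⟨ F≡ ⟩
            xs ++ a ∷ rest            ≡⟨ cong (xs ++_) a∷rest≡ ⟩
            xs ++ ys ++ [ b ] ++ zs   ≡⟨ cong (xs ++_) (sym (++-assoc ys [ b ] zs)) ⟩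
            xs ++ (ys ++ [ b ]) ++ zs ≡⟨ cong (λ r → xs ++ r ++ zs) (sym (toList-∷ʳ ys b)) ⟩
            xs ++ L⁺.toList (ys ∷ʳ b) ++ zs ∎

    module Restriction {k} (k+1<l : suc k < l) {R : Linkage n q} (rR : Restr W F k R) where

      private
        k<l : k < l
        k<l = <-trans (n<1+n k) k+1<l

        infix-of-path : ∀ α → ∃₂ λ xs ys → L⁺.toList (F α) ≡ xs ++ L⁺.toList (R α) ++ ys
        infix-of-path α = proj₁ (rR α)

      head-adh : ∀ α → Adh W k (L⁺.head (R α))
      head-adh α = proj₁ (proj₂ (rR α))

      last-adh : ∀ α → Adh W (suc k) (L⁺.last (R α))
      last-adh α = proj₂ (proj₂ (rR α))

      ⊆path : ∀ {α v} → v ∈P R α → v ∈P F α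
      ⊆path {α} {v} v∈ with infix-of-path α
      ... | xs , ys , F≡ = subst (v ∈_) (sym F≡) (∈-++⁺ʳ xs (∈-++⁺ˡ v∈))

      unique : ∀ α → Unique (L⁺.toList (R α))
      unique α with infix-of-path α
      ... | xs , ys , F≡ = Unique-++⁻ˡ (Unique-++⁻ʳ {xs = xs} (subst Unique F≡ (path-unique α)))

      linked : ∀ α → Linked (Adj G) (L⁺.toList (R α))
      linked α with infix-of-path α
      ... | xs , ys , F≡ = Linked-++⁻ˡ (Linked-++⁻ʳ {xs = xs} (subst (Linked (Adj G)) F≡ (path-linked α)))

      adh∩restriction≡head : ∀ {α v} → v ∈P R α → Adh W k v → v ≡ L⁺.head (R α)
      adh∩restriction≡head v∈ adh = adhesion-meets-once k<l (⊆path v∈) (⊆path (head∈toList _)) adh (head-adh _)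

      adh∩restriction≡last : ∀ {α v} → v ∈P R α → Adh W (suc k) v → v ≡ L⁺.last (R α)
      adh∩restriction≡last v∈ adh = adhesion-meets-once k+1<l (⊆path v∈) (⊆path (last∈toList _)) adh (last-adh _)

      -- F α meets each adhesion set once, and a vertex on the wrong side of R α would force a second crossing.
      path∩bag⊆ : ∀ {α v} → v ∈P F α → W (suc k) v → v ∈P R α
      path∩bag⊆ {α} {v} v∈ Wv with infix-of-path α
      ... | xs , ys , F≡ with ∈-++⁻ xs (subst (v ∈_) F≡ v∈)
      ...   | inj₁ v∈xs =
        ⊥-elim (Unique-++-disjoint (subst Unique F≡ (path-unique α)) head∈xs (∈-++⁺ˡ (head∈toList (R α))))
        where
        head∈xs : L⁺.head (R α) ∈ xs
        head∈xs = segment-crossing k<l (Linked-++⁻ˡ (subst (Linked (Adj G)) F≡ (path-linked α)))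
                    (λ u∈ → subst (_ ∈_) (sym F≡) (∈-++⁺ˡ u∈)) (head∈prefix (F α) xs _ F≡ v∈xs) v∈xs
                    (head-LeftOf k α) (suc k , ≤-refl , k<l , Wv) (⊆path (head∈toList (R α))) (head-adh α)
      ...   | inj₂ v∈R++ys with ∈-++⁻ (L⁺.toList (R α)) v∈R++ys
      ...     | inj₁ v∈R = v∈R
      ...     | inj₂ v∈ys =
        ⊥-elim (Unique-++-disjoint (Unique-++⁻ʳ {xs = xs} (subst Unique F≡ (path-unique α)))
                                   (last∈toList (R α)) last∈ys)
        where
        F≡′ : L⁺.toList (F α) ≡ (xs ++ L⁺.toList (R α)) ++ ys
        F≡′ = trans F≡ (sym (++-assoc xs _ ys))
        last∈ys : L⁺.last (R α) ∈ ys
        last∈ys = segment-crossing k+1<l (Linked-++⁻ʳ {xs = xs ++ _} (subst (Linked (Adj G)) F≡′ (path-linked α)))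
                    (λ u∈ → subst (_ ∈_) (sym F≡′) (∈-++⁺ʳ _ u∈)) v∈ys (last∈suffix (F α) _ ys F≡′ v∈ys)
                    (suc k , ≤-refl , Wv) (last-RightOf k+1<l α) (⊆path (last∈toList (R α))) (last-adh α)

      ⊆bag : ∀ {α v} → v ∈P R α → W (suc k) v
      ⊆bag {α} {v} v∈ with ∈-∃++ v∈ | bag-cover v
      ... | s₁ , s₂ , R≡ | i , i≤l , Wi with <-cmp i (suc k)
      ...   | tri≈ _ i≡k+1 _ = subst (λ j → W j v) i≡k+1 Wi
      ...   | tri< i<k+1 _ _ = subst (W (suc k)) head≡v (proj₂ (head-adh α))
        where
        head∈v∷s₂ : L⁺.head (R α) ∈ v ∷ s₂
        head∈v∷s₂ = segment-crossing k<l (Linked-++⁻ʳ {xs = s₁} (subst (Linked (Adj G)) R≡ (linked α)))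
                      (λ u∈ → ⊆path (subst (_ ∈_) (sym R≡) (∈-++⁺ʳ s₁ u∈)))
                      (here refl) (last∈suffix (R α) s₁ (v ∷ s₂) R≡ (here refl))
                      (i , m<1+n⇒m≤n i<k+1 , Wi) (suc (suc k) , n≤1+n (suc k) , k+1<l , proj₂ (last-adh α))
                      (⊆path (head∈toList (R α))) (head-adh α)
        head≡v : L⁺.head (R α) ≡ v
        head≡v = Unique-pivot (subst Unique R≡ (unique α))
                   (head∈prefix (R α) (s₁ ++ [ v ]) s₂ (trans R≡ (sym (++-assoc s₁ [ v ] s₂)))
                                (∈-++⁺ʳ s₁ (here refl)))
                   head∈v∷s₂
      ...   | tri> _ _ k+1<i = subst (W (suc k)) last≡v (proj₁ (last-adh α))
        where
        R≡′ : L⁺.toList (R α) ≡ (s₁ ++ [ v ]) ++ s₂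
        R≡′ = trans R≡ (sym (++-assoc s₁ [ v ] s₂))
        last∈s₁v : L⁺.last (R α) ∈ s₁ ++ [ v ]
        last∈s₁v = segment-crossing k+1<l (Linked-++⁻ˡ (subst (Linked (Adj G)) R≡′ (linked α)))
                     (λ u∈ → ⊆path (subst (_ ∈_) (sym R≡′) (∈-++⁺ˡ u∈)))
                     (head∈prefix (R α) (s₁ ++ [ v ]) s₂ R≡′ (∈-++⁺ʳ s₁ (here refl))) (∈-++⁺ʳ s₁ (here refl))
                     (suc k , ≤-refl , proj₂ (head-adh α)) (i , k+1<i , i≤l , Wi)
                     (⊆path (last∈toList (R α))) (last-adh α)
        last≡v : L⁺.last (R α) ≡ v
        last≡v = Unique-pivot (subst Unique R≡ (unique α)) last∈s₁v (last∈suffix (R α) s₁ (v ∷ s₂) R≡ (here refl))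

      Trivial⇒restriction-Trivial : ∀ {α} → Trivial (F α) → Trivial (R α)
      Trivial⇒restriction-Trivial {α} t =
        head≡last⇒Trivial (R α) (unique α)
          (trans (Trivial⇒≡head (F α) t (⊆path (head∈toList _)))
                 (sym (Trivial⇒≡head (F α) t (⊆path (last∈toList _)))))

  Trivial-transfer : ∀ {F F′ : Linkage n q} → IsFoundational G l W F → IsFoundational G l W F′ →
                     ∀ {γ} → L⁺.head (F′ γ) ≡ L⁺.head (F γ) → Trivial (F γ) → Trivial (F′ γ)
  Trivial-transfer {F} fF fF′ {γ} same-head t =
    Foundational.head∈lastAdh⇒Trivial fF′ γ
      (subst (Adh W (l ∸ 1)) (trans (Trivial⇒last≡head (F γ) t) (sym same-head)) (proj₁ (proj₂ (proj₂ fF γ))))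

module StableDecomposition {n q : ℕ} {G : Graph n} {l p : ℕ} {W : ℕ → VSet n} {P Q : Linkage n q}
  (reg : IsRegular G l p W P) (stab : IsStable G l W P)
  (fQ : IsFoundational G l W Q) (same-heads : ∀ α → L⁺.head (Q α) ≡ L⁺.head (P α)) where

  open SlimDecomposition {q = q} {G = G} {l = l} {W = W} (proj₁ reg)

  private
    fP : IsFoundational G l W P
    fP = proj₁ (proj₂ reg)

    L7 : ∀ α k → suc k < l → ∀ R → Restr W P k R → Trivial (R α) → Trivial (P α)
    L7 = proj₁ (proj₂ (proj₂ (proj₂ reg)))

  module FP = Foundational fP
  module FQ = Foundational fQ

  Trivial-P⇒Q : ∀ {γ} → Trivial (P γ) → Trivial (Q γ)
  Trivial-P⇒Q = Trivial-transfer fP fQ (same-heads _)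

  Trivial-Q⇒P : ∀ {γ} → Trivial (Q γ) → Trivial (P γ)
  Trivial-Q⇒P = Trivial-transfer fQ fP (sym (same-heads _))

  ∈Q∩Trivial-P⇒≡ : ∀ {α β v} → v ∈P Q α → v ∈P P β → Trivial (P β) → β ≡ α
  ∈Q∩Trivial-P⇒≡ {α} {β} v∈Q v∈P t =
    FQ.index-unique (subst (_∈P Q β) (trans (same-heads β) (sym (Trivial⇒≡head (P β) t v∈P))) (head∈toList (Q β))) v∈Q

  Matches : ℕ → (Fin q → Fin q) → Set
  Matches k σ = ∀ {α v} → v ∈P Q α → Adh W k v → v ∈P P (σ α)

  record Matching (k : ℕ) : Set where
    field
      σ σ⁻¹ : Fin q → Fin q
      σ∘σ⁻¹ : ∀ γ → σ (σ⁻¹ γ) ≡ γ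
      σ⁻¹∘σ : ∀ α → σ⁻¹ (σ α) ≡ α
      matches : Matches k σ

  matching : ∀ {k} → k < l → Matching k
  matching {k} k<l = record
    { σ = σ ; σ⁻¹ = λ γ → proj₁ (σ-onto γ) ; σ∘σ⁻¹ = λ γ → proj₂ (σ-onto γ)
    ; σ⁻¹∘σ = λ α → σ-injective (proj₂ (σ-onto (σ α))) ; matches = matches }
    where
    meet : Fin q → Fin n
    meet α = proj₁ (FQ.adhesion-meets k<l α)

    meet∈Q : ∀ α → meet α ∈P Q α
    meet∈Q α = proj₁ (proj₂ (FQ.adhesion-meets k<l α))

    meet-adh : ∀ α → Adh W k (meet α)
    meet-adh α = proj₂ (proj₂ (FQ.adhesion-meets k<l α))

    σ : Fin q → Fin q
    σ α = proj₁ (FP.adhesion⊆linkage k<l (meet-adh α))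

    meet∈P : ∀ α → meet α ∈P P (σ α)
    meet∈P α = proj₂ (FP.adhesion⊆linkage k<l (meet-adh α))

    matches : Matches k σ
    matches {α} v∈ adh = subst (_∈P P (σ α)) (FQ.adhesion-meets-once k<l (meet∈Q α) v∈ (meet-adh α) adh) (meet∈P α)

    σ-injective : ∀ {α β} → σ α ≡ σ β → α ≡ β
    σ-injective {α} {β} eq =
      FQ.index-unique (meet∈Q α)
        (subst (_∈P Q β) (FP.adhesion-meets-once k<l (meet∈P β) (subst (λ γ → meet α ∈P P γ) eq (meet∈P α))
                                                  (meet-adh β) (meet-adh α))
               (meet∈Q β))

    σ-onto : ∀ γ → ∃ λ α → σ α ≡ γ
    σ-onto = injective⇒surjective σ σ-injective

  relabelled-isLRLinkage : ∀ {k} (k+1<l : suc k < l) {R} → Restr W Q k R → (m : Matching k) →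
                           IsLRLinkage G W P k (λ γ → R (Matching.σ⁻¹ m γ))
  relabelled-isLRLinkage k+1<l {R} rR m =
    ((λ γ → unique (σ⁻¹ γ) , linked (σ⁻¹ γ) , All.tabulate (⊆bag {σ⁻¹ γ})) ,
     (λ γ δ γ≢δ v v∈γ v∈δ →
        γ≢δ (trans (sym (σ∘σ⁻¹ γ)) (trans (cong σ (FQ.index-unique (⊆path v∈γ) (⊆path v∈δ))) (σ∘σ⁻¹ δ))))) ,
    (λ γ → head-adh (σ⁻¹ γ) , last-adh (σ⁻¹ γ) , (λ _ → adh∩restriction≡head) , (λ _ → adh∩restriction≡last)) ,
    (λ γ → subst (λ δ → L⁺.head (R (σ⁻¹ γ)) ∈P P δ) (σ∘σ⁻¹ γ) (matches (⊆path (head∈toList _)) (head-adh (σ⁻¹ γ))))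
    where
    open Matching m
    open FQ.Restriction k+1<l rR

  matching-automorphism : ∀ {k} → suc k < l → ∀ {σ} → Matches k σ → IsAutomorphism {n} (Γ G l W P) σ
  matching-automorphism {zero} _ {σ} σ-matches = IsAutomorphism-resp {n = n} id≗σ (IsAutomorphism-id {n = n})
    where
    id≗σ : ∀ α → α ≡ σ α
    id≗σ α = FP.index-unique (subst (_∈P P α) (sym (same-heads α)) (head∈toList (P α)))
                             (σ-matches (head∈toList (Q α)) (proj₁ (proj₂ fQ α)))
  matching-automorphism {suc k} k+2<l {σ′} σ′-matches =
    IsAutomorphism-resp {n = n} (λ α → cong σ′ (σ⁻¹∘σ α))
      (IsAutomorphism-∘ {n = n} π-automorphism (matching-automorphism k+1<l matches))
    where
    k+1<l : suc k < l
    k+1<l = <-trans (n<1+n _) k+2<l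

    m : Matching k
    m = matching (<-trans (n<1+n k) k+1<l)
    open Matching m

    R : Linkage n q
    R = proj₁ (FQ.restriction k+1<l)

    rR : Restr W Q k R
    rR = proj₂ (FQ.restriction k+1<l)

    open FQ.Restriction k+1<l rR

    π-automorphism : IsAutomorphism {n} (Γ G l W P) (λ γ → σ′ (σ⁻¹ γ))
    π-automorphism = proj₁ (stab k k+1<l _ (relabelled-isLRLinkage k+1<l rR m))
                       (λ γ → σ′ (σ⁻¹ γ)) (λ γ → σ′-matches (⊆path (last∈toList (R (σ⁻¹ γ)))) (last-adh (σ⁻¹ γ)))

  restriction-bridge⇒Γ : ∀ {k} (k+1<l : suc k < l) {R} → Restr W Q k R → ∀ {α β} → α ≢ β → NonTrivial (P α) →
                         (B : Bridge G (W (suc k)) R) → AttachesTo B (R α) → AttachesTo B (R β) → Γ G l W P α β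
  restriction-bridge⇒Γ {k} k+1<l {R} rR {α} {β} α≢β α-nontrivial B att-α att-β =
    proj₂ (proj₂ (matching-automorphism k+1<l matches) α β)
      (proj₂ (stab k k+1<l _ (relabelled-isLRLinkage k+1<l rR m)) (σ α) (σ β) edge (inj₁ σα-nontrivial))
    where
    m : Matching k
    m = matching (<-trans (n<1+n k) k+1<l)
    open Matching m
    open FQ.Restriction k+1<l rR
    open Relabel {G = G} {U = W (suc k)} R {σ} {σ⁻¹} σ⁻¹∘σ

    edge : BEdge G (W (suc k)) R′ (σ α) (σ β)
    edge = (λ eq → α≢β (trans (sym (σ⁻¹∘σ α)) (trans (cong σ⁻¹ eq) (σ⁻¹∘σ β)))) ,
           bridge B , attaches B att-α , attaches B att-β

    σα-nontrivial : NonTrivial (P (σ α))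
    σα-nontrivial t =
      α-nontrivial (subst (λ γ → Trivial (P γ)) (∈Q∩Trivial-P⇒≡ head∈Q (matches head∈Q (head-adh α)) t) t)
      where head∈Q = ⊆path (head∈toList (R α))

  -- The vertex of R β lies in both adhesion sets of W (suc k), so the path of P[W (suc k)] through it is
  -- trivial; by (L7) that path of P is trivial, and then it is P β.
  restriction-Trivial⇒Trivial : ∀ {k} (k+1<l : suc k < l) {R} → Restr W Q k R → ∀ {β} → Trivial (R β) → Trivial (P β)
  restriction-Trivial⇒Trivial {k} k+1<l {R} rR {β} t =
    subst (λ γ → Trivial (P γ)) (∈Q∩Trivial-P⇒≡ v∈Q v∈P Pσβ-trivial) Pσβ-trivial
    where
    open Matching (matching (<-trans (n<1+n k) k+1<l))
    module RQ = FQ.Restriction k+1<l rR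
    RP = FP.restriction k+1<l
    module RP = FP.Restriction k+1<l (proj₂ RP)

    v : Fin n
    v = L⁺.head (R β)
    v∈Q : v ∈P Q β
    v∈Q = RQ.⊆path (head∈toList (R β))
    v∈P : v ∈P P (σ β)
    v∈P = matches v∈Q (RQ.head-adh β)
    v∈RP : v ∈P proj₁ RP (σ β)
    v∈RP = RP.path∩bag⊆ v∈P (proj₂ (RQ.head-adh β))

    Pσβ-trivial : Trivial (P (σ β))
    Pσβ-trivial = L7 (σ β) k k+1<l _ (proj₂ RP)
      (head≡last⇒Trivial _ (RP.unique (σ β))
        (trans (sym (RP.adh∩restriction≡head v∈RP (RQ.head-adh β)))
               (RP.adh∩restriction≡last v∈RP (subst (Adh W (suc k)) (Trivial⇒last≡head (R β) t) (RQ.last-adh β)))))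

module AttachedBridge {n q : ℕ} {G : Graph n} {l p : ℕ} {W : ℕ → VSet n} {P Q : Linkage n q}
  (p-connected : PConnected G p) (reg : IsRegular G l p W P) (stab : IsStable G l W P)
  (fQ : IsFoundational G l W Q) (same-heads : ∀ α → L⁺.head (Q α) ≡ L⁺.head (P α))
  (Q-attached : ∀ k → suc k < l → ∀ R → Restr W Q k R → PAttached G (W (suc k)) R p)
  {α : Fin q} (α-nontrivial : NonTrivial (P α))
  (α-sparse : ∀ βs → Unique βs → All (λ β → Γ G l W P α β × Trivial (P β)) βs → length βs + 3 ≤ p)
  {k : ℕ} (k+1<l : suc k < l) {R : Linkage n q} (rR : Restr W Q k R) {C : VSet n} (c : IsComponent G Full Q C)
  (C⊆W : ∀ v → C v → W (suc k) v) (att⊆W : ∀ s → NTAttachment G Q C s → W (suc k) s)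
  (att-α : AttachesTo (ntB {G = G} {Full} {Q} C c) (Q α)) where

  open StableDecomposition reg stab fQ same-heads

  open FQ.Restriction k+1<l rR
  open Sublinkage {G = G} {U = W (suc k)} {Q} {R} ⊆path path∩bag⊆

  private
    c′ : IsComponent G (W (suc k)) R C
    c′ = component C⊆W c

    att-α′ : AttachesTo (ntB {G = G} {W (suc k)} {R} C c′) (R α)
    att-α′ = attaches⁺ C⊆W c att⊆W att-α

    ¬3≤2 : ¬ 3 ≤ 2
    ¬3≤2 (s≤s (s≤s ()))

  AnotherPath : Set
  AnotherPath = ∃ λ β → β ≢ α × NonTrivial (P β) × AttachesTo (ntB {G = G} {Full} {Q} C c) (Q β)

  nontrivial-case : NonTrivial (R α) → AnotherPath
  nontrivial-case Rα-nontrivial with proj₂ (Q-attached k k+1<l R rR) C c′ α Rα-nontrivial att-α′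
  ... | inj₁ (β , β≢α , Rβ-nontrivial , att-β) =
    β , β≢α , (λ t → Rβ-nontrivial (Trivial⇒restriction-Trivial {β} (Trivial-P⇒Q {β} t))) ,
    attaches⁻ {c = c} {c′ = c′} att-β
  ... | inj₂ (βs , βs-unique , p≤ , βs-attached) =
    ⊥-elim (¬3≤2 (+-cancelˡ-≤ (length βs) 3 2 (≤-trans (α-sparse βs βs-unique (All.map neighbour βs-attached)) p≤)))
    where
    neighbour : ∀ {β} → Trivial (R β) × Σ (Bridge G (W (suc k)) R) (λ B → AttachesTo B (R α) × AttachesTo B (R β)) →
                Γ G l W P α β × Trivial (P β)
    neighbour (t , B , B-α , B-β) =
      restriction-bridge⇒Γ k+1<l rR (λ { refl → Rα-nontrivial t }) α-nontrivial B B-α B-β ,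
      restriction-Trivial⇒Trivial k+1<l rR t

  attachment⇒Γ : ∀ {γ s} → γ ≢ α → s ∈P Q γ → NTAttachment G Q C s → Γ G l W P α γ
  attachment⇒Γ γ≢α s∈γ att =
    restriction-bridge⇒Γ k+1<l rR (λ α≡γ → γ≢α (sym α≡γ)) α-nontrivial (ntB C c′) att-α′
                         (attaches⁺ C⊆W c att⊆W (_ , att , s∈γ))

  private
    x : Fin n
    x = L⁺.head (R α)

    head-Q : Fin q → Fin n
    head-Q β = L⁺.head (Q β)

    TrivialNeighbour : Fin q → Set₁
    TrivialNeighbour β = Γ G l W P α β × Trivial (P β)

  attachment-avoiding : ∀ βs → Unique βs → All TrivialNeighbour βs →
                        ∃ λ s → s ∉ x ∷ map head-Q βs × NTAttachment G Q C s
  attachment-avoiding βs u good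
    with NonTrivial⇒∃≢ (Q α) (FQ.path-unique α) (λ t → α-nontrivial (Trivial-Q⇒P {α} t)) x
  ... | y , y∈Q , y≢x = component-attachment-avoiding {G = G} {p = p} p-connected c X |X|<p X⊆Q (α , y∈Q) y∉X
    where
    X : List (Fin n)
    X = x ∷ map head-Q βs

    |X|<p : length X < p
    |X|<p = subst (λ m → suc m < p) (sym (length-map head-Q βs))
              (≤-trans (subst (suc (suc (length βs)) ≤_) (+-comm 3 (length βs)) (n≤1+n _)) (α-sparse βs u good))

    X⊆Q : ∀ {v} → v ∈ X → OnLink Q v
    X⊆Q (here refl) = α , ⊆path (head∈toList (R α))
    X⊆Q (there v∈) with ∈-map⁻ head-Q v∈
    ... | β , _ , refl = β , head∈toList (Q β)

    y∉X : y ∉ X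
    y∉X (here y≡x) = y≢x y≡x
    y∉X (there y∈) with ∈-map⁻ head-Q y∈
    ... | β , β∈βs , y≡ = α-nontrivial (subst (λ γ → Trivial (P γ)) β≡α (proj₂ (All.lookup good β∈βs)))
      where
      β≡α : β ≡ α
      β≡α = FQ.index-unique (subst (_∈P Q β) (sym y≡) (head∈toList (Q β))) y∈Q

  new-path-or-neighbour : Trivial (R α) → ∀ βs {s} → s ∉ x ∷ map head-Q βs → NTAttachment G Q C s →
                          AnotherPath ⊎ ∃ λ γ → γ ∉ βs × TrivialNeighbour γ
  new-path-or-neighbour Rα-trivial βs {s} s∉X att@((γ , s∈γ) , _) with γ ≟F α
  ... | yes refl = ⊥-elim (s∉X (here (Trivial⇒≡head (R α) Rα-trivial (path∩bag⊆ s∈γ (att⊆W s att)))))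
  ... | no γ≢α with Trivial? (Q γ)
  ...   | no Qγ-nontrivial = inj₁ (γ , γ≢α , (λ t → Qγ-nontrivial (Trivial-P⇒Q {γ} t)) , s , att , s∈γ)
  ...   | yes Qγ-trivial with DecMembership._∈?_ _≟F_ γ βs
  ...     | yes γ∈βs = ⊥-elim (s∉X (there (subst (_∈ map head-Q βs) (sym (Trivial⇒≡head (Q γ) Qγ-trivial s∈γ))
                                                   (∈-map⁺ head-Q γ∈βs))))
  ...     | no γ∉βs = inj₂ (γ , γ∉βs , attachment⇒Γ γ≢α s∈γ att , Trivial-Q⇒P {γ} Qγ-trivial)

  trivial-case : Trivial (R α) → AnotherPath
  trivial-case Rα-trivial = boundedGrowth (p ∸ 3) (λ βs u good → m+n≤o⇒m≤o∸n (length βs) (α-sparse βs u good))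
    λ βs u good → let _ , s∉X , att = attachment-avoiding βs u good in new-path-or-neighbour Rα-trivial βs s∉X att

  another-path : AnotherPath
  another-path with Trivial? (R α)
  ... | yes Rα-trivial = trivial-case Rα-trivial
  ... | no Rα-nontrivial = nontrivial-case Rα-nontrivial

lemma21 : ∀ {n q : ℕ} (G : Graph n) (l p : ℕ) (W : ℕ → VSet n) (P : Linkage n q)
  → 3 ≤ l → PConnected G p
  → IsRegular G l p W P → IsStable G l W P
  → (Q : Linkage n q) → IsFoundational G l W Q
  → (∀ α → L⁺.head (Q α) ≡ L⁺.head (P α))
  → (∀ k → suc k < l → ∀ R → Restr W Q k R → PAttached G (W (suc k)) R p)
  → (λ₀ : Fin q → Set) → (∀ α → λ₀ α → NonTrivial (P α))
  → (∀ α → λ₀ α → ∀ (βs : List (Fin q)) → Unique βs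
       → All (λ β → Γ G l W P α β × Trivial (P β)) βs → length βs + 3 ≤ p)
  → ∀ k → suc k < l → ∀ C (c : IsComponent G Full Q C)
  → (∀ v → C v → W (suc k) v) → (∀ s → NTAttachment G Q C s → W (suc k) s)
  → ∀ α → λ₀ α → AttachesTo (ntB {G = G} {Full} {Q} C c) (Q α)
  → ∃ λ β → β ≢ α × NonTrivial (P β) × AttachesTo (ntB {G = G} {Full} {Q} C c) (Q β)
lemma21 G l p W P _ p-connected reg stab Q fQ same-heads Q-attached λ₀ λ₀⊆λ λ₀-sparse
        k k+1<l C c C⊆W att⊆W α α∈λ₀ att-α =
  AttachedBridge.another-path p-connected reg stab fQ same-heads Q-attached (λ₀⊆λ α α∈λ₀) (λ₀-sparse α α∈λ₀)
                              k+1<l (proj₂ (Foundational.restriction {F = Q} fQ k+1<l)) c C⊆W att⊆W att-α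
  where open SlimDecomposition {G = G} {l = l} {W = W} (proj₁ reg)
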